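{- Let $\mathbf{B}$ be a topological Boolean algebra, $\nabla$ an open filter and $\Delta$ a closed ideal of $\mathbf{B}$, $\mathbf{T}=Tw(\mathbf{B},\nabla,\Delta)$, and suppose that $(\Box a,\Box b)\in\mathbf{T}$ for all $(a,b)\in\mathbf{T}$. Then $\mathsf{G}(\mathbf{B})=\Gamma(\mathbf{T})=\Lambda(\mathbf{B},\nabla)$, and for every formula $\varphi$ of the language $\{\wedge,\vee,\to,\bot,\sim\}$: $$\mathcal{G}_2(\mathbf{T})\models\varphi\iff\mathbf{T}\models\mathrm{T}_{\mathbf{B}}\varphi.$$
   Context: A topological Boolean algebra (TBA) is an algebra $\mathbf{B}=\langle B;\vee,\wedge,\to,\bot,\Box\rangle$ whose reduct is a Boolean algebra (top $1$, $\neg a:=a\to\bot$) with $\Box 1=1$, $\Box(a\wedge b)=\Box a\wedge\Box b$, $\Box a\le a$, $\Box a\le\Box\Box a$; $\Diamond a:=\neg\Box\neg a$. $\mathsf{G}(\mathbf{B})=\{a\in B:\Box a=a\}$; $\mathcal{G}(\mathbf{B})$ is the Heyting algebra on $\mathsf{G}(\mathbf{B})$ with $\vee,\wedge,\bot$ of $\mathbf{B}$ and $a\to_{\mathcal{G}(\mathbf{B})}b:=\Box(a\to b)$. Full twist-structure $\mathbf{C}^{\bowtie}$ over a Heyting algebra or TBA $\mathbf{C}$: universe $C\times C$, $(a,b)\vee(c,d)=(a\vee c,b\wedge d)$, $(a,b)\wedge(c,d)=(a\wedge c,b\vee d)$, $(a,b)\to(c,d)=(a\to c,a\wedge d)$,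 $\bot=(\bot,1)$, $\sim(a,b)=(b,a)$, and for a TBA $\Box(a,b)=(\Box a,\Diamond b)$, $\Diamond(a,b)=(\Diamond a,\Box b)$. A filter is open if closed under $\Box$, an ideal closed if closed under $\Diamond$. $Tw(\mathbf{B},\nabla,\Delta)$ is the subalgebra of $\mathbf{B}^{\bowtie}$ on $\{(a,b):a\vee b\in\nabla,\ a\wedge b\in\Delta\}$. For $\mathbf{T}=Tw(\mathbf{B},\nabla,\Delta)$: $\mathsf{G}_2(\mathbf{T})=\{(a,b)\in\mathbf{T}:\Box a=a,\Box b=b\}$, $\Gamma(\mathbf{T})=\pi_1(\mathsf{G}_2(\mathbf{T}))$, $\Lambda(\mathbf{B},\nabla)=\{a\in\mathsf{G}(\mathbf{B}):a\vee\Box\neg a\in\nabla\}$, and $\mathcal{G}_2(\mathbf{T})$ is the algebra on $\mathsf{G}_2(\mathbf{T})$ with the operations $\vee,\wedge,\to,\bot,\sim$ of $\mathcal{G}(\mathbf{B})^{\bowtie}$ (so $(a,b)\to(c,d)=(\Box(a\to c),a\wedge d)$), which under the hypotheses is a twist-structure over a subalgebra of $\mathcal{G}(\mathbf{B})$. Validity: for a twist-structure $\mathcal{A}$ (over a Heyting algebra or TBA) and a formula $\varphi$ in its language, $\mathcal{A}\models\varphi$ iff $\pi_1(v(\varphi))=1$ for every homomorphism $v$ from the formula algebra into $\mathcal{A}$. The translation $\mathrm{T}_{\mathbf{B}}$ from formulas of $\{\wedge,\vee,\to,\bot,\sim\}$ to formulas of $\{\wedge,\vee,\to,\bot,\sim,\Box,\Diamond\}$: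 $\mathrm{T}_{\mathbf{B}}(p)=\Box p$, $\mathrm{T}_{\mathbf{B}}(\sim p)=\Box\sim p$, $\mathrm{T}_{\mathbf{B}}(\bot)=\bot$, $\mathrm{T}_{\mathbf{B}}(\sim\bot)=\sim\bot$, $\mathrm{T}_{\mathbf{B}}(\varphi\wedge\psi)=\mathrm{T}_{\mathbf{B}}\varphi\wedge\mathrm{T}_{\mathbf{B}}\psi$, $\mathrm{T}_{\mathbf{B}}(\varphi\vee\psi)=\mathrm{T}_{\mathbf{B}}\varphi\vee\mathrm{T}_{\mathbf{B}}\psi$, $\mathrm{T}_{\mathbf{B}}(\varphi\to\psi)=\Box(\mathrm{T}_{\mathbf{B}}\varphi\to\mathrm{T}_{\mathbf{B}}\psi)$, $\mathrm{T}_{\mathbf{B}}(\sim(\varphi\wedge\psi))=\mathrm{T}_{\mathbf{B}}(\sim\varphi)\vee\mathrm{T}_{\mathbf{B}}(\sim\psi)$, $\mathrm{T}_{\mathbf{B}}(\sim(\varphi\vee\psi))=\mathrm{T}_{\mathbf{B}}(\sim\varphi)\wedge\mathrm{T}_{\mathbf{B}}(\sim\psi)$, $\mathrm{T}_{\mathbf{B}}(\sim(\varphi\to\psi))=\mathrm{T}_{\mathbf{B}}\varphi\wedge\mathrm{T}_{\mathbf{B}}(\sim\psi)$, $\mathrm{T}_{\mathbf{B}}(\sim\sim\varphi)=\mathrm{T}_{\mathbf{B}}\varphi$ (even iterations of $\sim$ are removed). -}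

module Defs where

open import Level using (Level; _⊔_) renaming (suc to lsuc)
open import Data.Nat using (ℕ)
open import Data.Product using (_×_; _,_; proj₁; proj₂; Σ; ∃)
open import Relation.Binary.Core using (Rel; _Preserves_⟶_)
open import Relation.Unary using (Pred; _∈_)
open import Algebra.Lattice.Bundles using (BooleanAlgebra)

record TBA (c ℓ : Level) : Set (lsuc (c ⊔ ℓ)) where
  field
    booleanAlgebra : BooleanAlgebra c ℓ
  open BooleanAlgebra booleanAlgebra public

  infix 4 _≤_
  _≤_ : Rel Carrier ℓ
  a ≤ b = (a ∧ b) ≈ a

  infixr 5 _⇒_
  _⇒_ : Carrier → Carrier → Carrier
  a ⇒ b = (¬ a) ∨ b

  field
    □      : Carrier → Carrier
    □-cong : □ Preserves _≈_ ⟶ _≈_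
    □-⊤    : □ ⊤ ≈ ⊤
    □-∧    : ∀ a b → □ (a ∧ b) ≈ (□ a ∧ □ b)
    □-≤    : ∀ a → □ a ≤ a
    □-□    : ∀ a → □ a ≤ □ (□ a)

  ◇ : Carrier → Carrier
  ◇ a = ¬ (□ (¬ a))

  G : Pred Carrier ℓ
  G a = □ a ≈ a

module _ {c ℓ : Level} (B : TBA c ℓ) where
  open TBA B

  -- filters / ideals (not required to be proper)
  record IsFilter {p : Level} (F : Pred Carrier p) : Set (c ⊔ ℓ ⊔ p) where
    field
      ⊤∈   : ⊤ ∈ F
      up   : ∀ {a b} → a ≤ b → a ∈ F → b ∈ F
      ∧∈   : ∀ {a b} → a ∈ F → b ∈ F → (a ∧ b) ∈ F

  record IsOpenFilter {p : Level} (F : Pred Carrier p) : Set (c ⊔ ℓ ⊔ p) where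
    field
      isFilter : IsFilter F
      □∈       : ∀ {a} → a ∈ F → □ a ∈ F

  record IsIdeal {p : Level} (I : Pred Carrier p) : Set (c ⊔ ℓ ⊔ p) where
    field
      ⊥∈   : ⊥ ∈ I
      down : ∀ {a b} → a ≤ b → b ∈ I → a ∈ I
      ∨∈   : ∀ {a b} → a ∈ I → b ∈ I → (a ∨ b) ∈ I

  record IsClosedIdeal {p : Level} (I : Pred Carrier p) : Set (c ⊔ ℓ ⊔ p) where
    field
      isIdeal : IsIdeal I
      ◇∈      : ∀ {a} → a ∈ I → ◇ a ∈ I

  Tw² : Set c
  Tw² = Carrier × Carrier

  _∨ᵗ_ _∧ᵗ_ _⇒ᵗ_ : Tw² → Tw² → Tw²
  (a , b) ∨ᵗ (c' , d) = (a ∨ c' , b ∧ d)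
  (a , b) ∧ᵗ (c' , d) = (a ∧ c' , b ∨ d)
  (a , b) ⇒ᵗ (c' , d) = (a ⇒ c' , a ∧ d)

  ⊥ᵗ : Tw²
  ⊥ᵗ = (⊥ , ⊤)

  ∼ᵗ □ᵗ ◇ᵗ : Tw² → Tw²
  ∼ᵗ (a , b) = (b , a)
  □ᵗ (a , b) = (□ a , ◇ b)
  ◇ᵗ (a , b) = (◇ a , □ b)

  _⇒ᴳ_ : Tw² → Tw² → Tw²
  (a , b) ⇒ᴳ (c' , d) = (□ (a ⇒ c') , a ∧ d)

  module _ {p q : Level} (∇ : Pred Carrier p) (Δ : Pred Carrier q) where

    InTw : Pred Tw² (p ⊔ q)
    InTw (a , b) = ((a ∨ b) ∈ ∇) × ((a ∧ b) ∈ Δ)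

    InG₂ : Pred Tw² (ℓ ⊔ p ⊔ q)
    InG₂ (a , b) = InTw (a , b) × (□ a ≈ a) × (□ b ≈ b)

    Γ : Pred Carrier (c ⊔ ℓ ⊔ p ⊔ q)
    Γ a = ∃ λ b → InG₂ (a , b)

  Λ : {p : Level} → Pred Carrier p → Pred Carrier (ℓ ⊔ p)
  Λ ∇ a = (□ a ≈ a) × ((a ∨ □ (¬ a)) ∈ ∇)

data Fm : Set where
  var  : ℕ → Fm
  ⊥f   : Fm
  _∧f_ : Fm → Fm → Fm
  _∨f_ : Fm → Fm → Fm
  _⇒f_ : Fm → Fm → Fm
  ∼f_  : Fm → Fm

data MFm : Set where
  var  : ℕ → MFm
  ⊥m   : MFm
  _∧m_ : MFm → MFm → MFm
  _∨m_ : MFm → MFm → MFm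
  _⇒m_ : MFm → MFm → MFm
  ∼m_  : MFm → MFm
  □m_  : MFm → MFm
  ◇m_  : MFm → MFm

-- The translation T_B.  trN φ is T_B(∼φ).
mutual
  tr : Fm → MFm
  tr (var n)   = □m (var n)
  tr ⊥f        = ⊥m
  tr (φ ∧f ψ)  = tr φ ∧m tr ψ
  tr (φ ∨f ψ)  = tr φ ∨m tr ψ
  tr (φ ⇒f ψ)  = □m (tr φ ⇒m tr ψ)
  tr (∼f φ)    = trN φ

  trN : Fm → MFm
  trN (var n)  = □m (∼m (var n))
  trN ⊥f       = ∼m ⊥m
  trN (φ ∧f ψ) = trN φ ∨m trN ψ
  trN (φ ∨f ψ) = trN φ ∧m trN ψ
  trN (φ ⇒f ψ) = tr φ ∧m trN ψ
  trN (∼f φ)   = tr φ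

module _ {c ℓ : Level} (B : TBA c ℓ) where
  open TBA B

  evalT : (ℕ → Tw² B) → MFm → Tw² B
  evalT v (var n)  = v n
  evalT v ⊥m       = ⊥ᵗ B
  evalT v (φ ∧m ψ) = _∧ᵗ_ B (evalT v φ) (evalT v ψ)
  evalT v (φ ∨m ψ) = _∨ᵗ_ B (evalT v φ) (evalT v ψ)
  evalT v (φ ⇒m ψ) = _⇒ᵗ_ B (evalT v φ) (evalT v ψ)
  evalT v (∼m φ)   = ∼ᵗ B (evalT v φ)
  evalT v (□m φ)   = □ᵗ B (evalT v φ)
  evalT v (◇m φ)   = ◇ᵗ B (evalT v φ)

  evalG : (ℕ → Tw² B) → Fm → Tw² B
  evalG v (var n)  = v n
  evalG v ⊥f       = ⊥ᵗ B
  evalG v (φ ∧f ψ) = _∧ᵗ_ B (evalG v φ) (evalG v ψ)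
  evalG v (φ ∨f ψ) = _∨ᵗ_ B (evalG v φ) (evalG v ψ)
  evalG v (φ ⇒f ψ) = _⇒ᴳ_ B (evalG v φ) (evalG v ψ)
  evalG v (∼f φ)   = ∼ᵗ B (evalG v φ)

  module _ {p q : Level} (∇ : Pred Carrier p) (Δ : Pred Carrier q) where

    _⊨T_ : MFm → Set (c ⊔ ℓ ⊔ p ⊔ q)
    _⊨T_ φ = (v : ℕ → Tw² B) → (∀ n → InTw B ∇ Δ (v n)) → proj₁ (evalT v φ) ≈ ⊤

    _⊨G₂_ : Fm → Set (c ⊔ ℓ ⊔ p ⊔ q)
    _⊨G₂_ φ = (v : ℕ → Tw² B) → (∀ n → InG₂ B ∇ Δ (v n)) → proj₁ (evalG v φ) ≈ ⊤

-- Boxing both coordinates maps T into G₂(T) (this is the hypothesis) and fixes G₂(T) pointwise,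
-- and T_B φ evaluated at a valuation v has the first coordinate of φ evaluated in G₂(T) at the
-- boxed valuation. Hence the two validity notions coincide. For the first part, an open a lies
-- in Γ(T) with witness (a, □¬a): the pair (a, ¬a) is in T since a ∨ ¬a = ⊤ and a ∧ ¬a = ⊥, and
-- boxing it keeps it in T; its first membership condition is exactly a ∨ □¬a ∈ ∇.
module Submission where

open import Defs
open import Level using (Level)
open import Data.Nat using (ℕ)
open import Data.Product using (_×_; _,_; proj₁; proj₂)
open import Data.Product.Relation.Binary.Pointwise.NonDependent using (Pointwise)
open import Relation.Unary using (Pred)
open import Function using (_∘′_)
open import Function.Bundles using (_⇔_; mk⇔)
import Algebra.Lattice.Properties.BooleanAlgebra as BooleanAlgebraProperties

module _ {c ℓ : Level} (B : TBA c ℓ) where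
  open TBA B
  open BooleanAlgebraProperties booleanAlgebra using (∧-idem)

  ≈⇒≤ : ∀ {a b} → a ≈ b → a ≤ b
  ≈⇒≤ {a} a≈b = trans (∧-cong refl (sym a≈b)) (∧-idem a)

  □-idem : ∀ a → □ (□ a) ≈ □ a
  □-idem a = trans (sym (□-≤ (□ a))) (trans (∧-comm _ _) (□-□ a))

  □² : Tw² B → Tw² B
  □² (a , b) = (□ a , □ b)

  module _ {v w : ℕ → Tw² B} (w≈□²v : ∀ n → Pointwise _≈_ _≈_ (w n) (□² (v n))) where
    mutual
      evalT-tr : ∀ φ → proj₁ (evalT B v (tr φ)) ≈ proj₁ (evalG B w φ)
      evalT-tr (var n)  = sym (proj₁ (w≈□²v n))
      evalT-tr ⊥f       = refl
      evalT-tr (φ ∧f ψ) = ∧-cong (evalT-tr φ) (evalT-tr ψ)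
      evalT-tr (φ ∨f ψ) = ∨-cong (evalT-tr φ) (evalT-tr ψ)
      evalT-tr (φ ⇒f ψ) = □-cong (∨-cong (¬-cong (evalT-tr φ)) (evalT-tr ψ))
      evalT-tr (∼f φ)   = evalT-trN φ

      evalT-trN : ∀ φ → proj₁ (evalT B v (trN φ)) ≈ proj₂ (evalG B w φ)
      evalT-trN (var n)  = sym (proj₂ (w≈□²v n))
      evalT-trN ⊥f       = refl
      evalT-trN (φ ∧f ψ) = ∨-cong (evalT-trN φ) (evalT-trN ψ)
      evalT-trN (φ ∨f ψ) = ∧-cong (evalT-trN φ) (evalT-trN ψ)
      evalT-trN (φ ⇒f ψ) = ∧-cong (evalT-tr φ) (evalT-trN ψ)
      evalT-trN (∼f φ)   = evalT-tr φ

  module _ {p q : Level} {∇ : Pred Carrier p} {Δ : Pred Carrier q}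
           (open-∇ : IsOpenFilter B ∇) (closed-Δ : IsClosedIdeal B Δ) where
    open IsFilter (IsOpenFilter.isFilter open-∇)
    open IsIdeal (IsClosedIdeal.isIdeal closed-Δ)

    InTw-resp : ∀ {x y} → Pointwise _≈_ _≈_ x y → InTw B ∇ Δ x → InTw B ∇ Δ y
    InTw-resp (a≈a′ , b≈b′) (a∨b∈∇ , a∧b∈Δ) =
      up (≈⇒≤ (∨-cong a≈a′ b≈b′)) a∨b∈∇ , down (≈⇒≤ (∧-cong (sym a≈a′) (sym b≈b′))) a∧b∈Δ

    complement∈Tw : ∀ a → InTw B ∇ Δ (a , ¬ a)
    complement∈Tw a = up (≈⇒≤ (sym (∨-complementʳ a))) ⊤∈ , down (≈⇒≤ (∧-complementʳ a)) ⊥∈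

    module _ (□²-closed : ∀ a b → InTw B ∇ Δ (a , b) → InTw B ∇ Δ (□ a , □ b)) where

      □²∈G₂ : ∀ {x} → InTw B ∇ Δ x → InG₂ B ∇ Δ (□² x)
      □²∈G₂ x∈T = □²-closed _ _ x∈T , □-idem _ , □-idem _

      open⇒∈G₂ : ∀ {a} → G a → InG₂ B ∇ Δ (a , □ (¬ a))
      open⇒∈G₂ {a} □a≈a = InTw-resp (□a≈a , refl) (proj₁ □²a¬a) , □a≈a , proj₂ (proj₂ □²a¬a)
        where
          □²a¬a : InG₂ B ∇ Δ (□ a , □ (¬ a))
          □²a¬a = □²∈G₂ (complement∈Tw a)

      G⇔Γ : ∀ a → G a ⇔ Γ B ∇ Δ a
      G⇔Γ a = mk⇔ (λ a∈G → □ (¬ a) , open⇒∈G₂ a∈G) (λ (_ , _ , □a≈a , _) → □a≈a)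

      Γ⇔Λ : ∀ a → Γ B ∇ Δ a ⇔ Λ B ∇ a
      Γ⇔Λ a = mk⇔ (λ (_ , _ , □a≈a , _) → □a≈a , proj₁ (proj₁ (open⇒∈G₂ □a≈a)))
                  (λ (□a≈a , _) → □ (¬ a) , open⇒∈G₂ □a≈a)

      ⊨G₂⇔⊨T-tr : ∀ φ → _⊨G₂_ B ∇ Δ φ ⇔ _⊨T_ B ∇ Δ (tr φ)
      ⊨G₂⇔⊨T-tr φ = mk⇔ ⊨G₂⇒⊨T ⊨T⇒⊨G₂
        where
          ⊨G₂⇒⊨T : _⊨G₂_ B ∇ Δ φ → _⊨T_ B ∇ Δ (tr φ)
          ⊨G₂⇒⊨T ⊨φ v v∈T =
            trans (evalT-tr {v = v} (λ _ → refl , refl) φ) (⊨φ (□² ∘′ v) (λ n → □²∈G₂ (v∈T n)))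

          ⊨T⇒⊨G₂ : _⊨T_ B ∇ Δ (tr φ) → _⊨G₂_ B ∇ Δ φ
          ⊨T⇒⊨G₂ ⊨trφ w w∈G₂ =
            trans (sym (evalT-tr {v = w} □²-fixes-w φ)) (⊨trφ w (λ n → proj₁ (w∈G₂ n)))
            where
              □²-fixes-w : ∀ n → Pointwise _≈_ _≈_ (w n) (□² (w n))
              □²-fixes-w n = sym (proj₁ (proj₂ (w∈G₂ n))) , sym (proj₂ (proj₂ (w∈G₂ n)))

proposition3p2p2 : {c ℓ p q : Level} (B : TBA c ℓ)
    (∇ : Pred (TBA.Carrier B) p) (Δ : Pred (TBA.Carrier B) q) →
    IsOpenFilter B ∇ → IsClosedIdeal B Δ →
    (∀ a b → InTw B ∇ Δ (a , b) → InTw B ∇ Δ (TBA.□ B a , TBA.□ B b)) →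
    ((∀ a → TBA.G B a ⇔ Γ B ∇ Δ a) × (∀ a → Γ B ∇ Δ a ⇔ Λ B ∇ a))
    × (∀ φ → (_⊨G₂_ B ∇ Δ φ) ⇔ (_⊨T_ B ∇ Δ (tr φ)))
proposition3p2p2 B ∇ Δ open-∇ closed-Δ □²-closed =
  (G⇔Γ B open-∇ closed-Δ □²-closed , Γ⇔Λ B open-∇ closed-Δ □²-closed)
  , ⊨G₂⇔⊨T-tr B open-∇ closed-Δ □²-closed
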